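{- Let $t>1$ be odd, let $S\subseteq\{2,\dots,4t-2\}$, and let $M=\big(\circ_{i\in S}M_{\partial_i}\big)\circ R$ (entrywise product; for $S=\emptyset$, $M=R$). Let $2\le n\le 4t$. Then: (1) if $n\equiv 1 \pmod 4$, the sum of the entries of row $n$ of $M$ is zero if and only if $c_n=t$; (2) if $n\equiv 0,2,3 \pmod 4$, the sum of the entries of row $n$ of $M$ is zero if and only if $c_n=I_n$.
   Context: $G=\mathbb{Z}_t\times\mathbb{Z}_2^2=\langle x,u,v\mid x^t=u^2=v^2=1,\ uv=vu\rangle$ (abelian), with elements ordered $g_{4i+1}=x^i$, $g_{4i+2}=x^iu$, $g_{4i+3}=x^iv$, $g_{4i+4}=x^iuv$ for $0\le i\le t-1$. For $1\le i\le 4t$ let $\delta_i:G\to\{\pm1\}$ with $\delta_i(g)=-1$ iff $g=g_i$. The coboundary matrix $M_{\partial_i}$ is the $4t\times 4t$ matrix with $(s,j)$ entry $\delta_i(g_s)\delta_i(g_j)\delta_i(g_sg_j)$; the generalized coboundary matrix $N_i$ has $(s,j)$ entry $\delta_i(g_j)\delta_i(g_sg_j)$ (for $s\ge2$ its row $s$ has exactly two entries $-1$, in columns $i$ and $e$ with $g_e=g_s^{ -1}g_i$). $R=J_t\otimes A$, where $J_t$ is the $t\times t$ all-ones matrix, $\otimes$ is the Kronecker product, and $A$ is the $4\times4$ matrix with rows $(1,1,1,1),(1,-1,1,-1),(1,-1,-1,1),(1,1,-1,-1)$. For the set $\mathcal{N}=\{N_i:i\in S\}$ and row $n$: form the graph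 on $\mathcal{N}$ in which two matrices are adjacent iff they have a $-1$ entry in a common position of row $n$; a connected component is called an $n$-path if some member of it has a $-1$ entry in row $n$ in common position with some $N_j$, $1\le j\le 4t$, $j\notin S$. $c_n$ is the number of $n$-path components. $I_n$ is the number of columns $j$ such that both $R$ and the entrywise product $\circ_{i\in S}N_i$ have entry $-1$ at position $(n,j)$. -}

module Defs where

open import Data.Nat using (ℕ; zero; suc; _≤_; _<_; NonZero)
  renaming (_+_ to _+ℕ_; _*_ to _*ℕ_; _∸_ to _∸ℕ_)
open import Data.Nat.DivMod using (_%_; _/_)
open import Data.Integer using (ℤ; _*_; _+_; -_; 1ℤ; 0ℤ; -1ℤ)
import Data.Integer.Properties as ℤP
import Data.Nat.Properties as ℕP
open import Data.List using (List; []; _∷_; map; foldr; upTo; filter; length)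
open import Data.List.Membership.Propositional using (_∈_; _∉_)
open import Data.Product using (Σ; ∃; _×_; _,_)
open import Relation.Binary.PropositionalEquality using (_≡_; _≢_)
open import Relation.Binary.Construct.Closure.ReflexiveTransitive using (Star)
open import Relation.Nullary using (¬_; Dec)
open import Relation.Nullary.Decidable using (_×-dec_)
open import Data.List.Relation.Unary.AllPairs using (AllPairs)
open import Data.List.Relation.Unary.All using (All)
open import Data.List.Relation.Unary.Any using (Any)

-- The group G = Z_t × Z_2^2, elements indexed 1 … 4t (paper's order):
-- index k = 4i + r + 1 (0 ≤ i < t, 0 ≤ r ≤ 3) is x^i, x^i u, x^i v, x^i uv
-- for r = 0, 1, 2, 3 respectively (bit 0 of r = power of u, bit 1 = v).

module _ (t : ℕ) .{{_ : NonZero t}} where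

  xPow : ℕ → ℕ
  xPow k = (k ∸ℕ 1) / 4

  uvPart : ℕ → ℕ
  uvPart k = (k ∸ℕ 1) % 4

  xor4 : ℕ → ℕ → ℕ
  xor4 a b = ((a % 2 +ℕ b % 2) % 2) +ℕ 2 *ℕ (((a / 2) +ℕ (b / 2)) % 2)

  mul : ℕ → ℕ → ℕ
  mul s j = 4 *ℕ ((xPow s +ℕ xPow j) % t) +ℕ xor4 (uvPart s) (uvPart j) +ℕ 1

  δ : ℕ → ℕ → ℤ
  δ i k with k Data.Nat.≟ i
  ... | Relation.Nullary.yes _ = -1ℤ
  ... | Relation.Nullary.no _  = 1ℤ

  Mδ : ℕ → ℕ → ℕ → ℤ
  Mδ i s j = δ i s * δ i j * δ i (mul s j)

  Nδ : ℕ → ℕ → ℕ → ℤ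
  Nδ i s j = δ i j * δ i (mul s j)

  -- the 4×4 matrix A, 0-indexed
  A : ℕ → ℕ → ℤ
  A 0 _ = 1ℤ
  A 1 0 = 1ℤ
  A 1 1 = -1ℤ
  A 1 2 = 1ℤ
  A 1 _ = -1ℤ
  A 2 0 = 1ℤ
  A 2 1 = -1ℤ
  A 2 2 = -1ℤ
  A 2 _ = 1ℤ
  A _ 0 = 1ℤ
  A _ 1 = 1ℤ
  A _ _ = -1ℤ

  -- R = J_t ⊗ A (1-indexed entries)
  Rm : ℕ → ℕ → ℤ
  Rm s j = A (uvPart s) (uvPart j)

  indices : List ℕ
  indices = map suc (upTo (4 *ℕ t))

  prodℤ : List ℤ → ℤ
  prodℤ = foldr _*_ 1ℤ

  sumℤ : List ℤ → ℤ
  sumℤ = foldr _+_ 0ℤ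

  Mmat : List ℕ → ℕ → ℕ → ℤ
  Mmat S s j = prodℤ (map (λ i → Mδ i s j) S) * Rm s j

  rowSum : List ℕ → ℕ → ℤ
  rowSum S n = sumℤ (map (Mmat S n) indices)

  Nprod : List ℕ → ℕ → ℕ → ℤ
  Nprod S s j = prodℤ (map (λ i → Nδ i s j) S)

  I : List ℕ → ℕ → ℕ
  I S n = length (filter (λ j → (Rm n j Data.Integer.≟ -1ℤ) ×-dec (Nprod S n j Data.Integer.≟ -1ℤ)) indices)

  CommonNeg : ℕ → ℕ → ℕ → Set
  CommonNeg n i k = ∃ λ j → j ∈ indices × Nδ i n j ≡ -1ℤ × Nδ k n j ≡ -1ℤ

  Adj : List ℕ → ℕ → ℕ → ℕ → Set
  Adj S n i k = i ∈ S × k ∈ S × CommonNeg n i k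

  Connected : List ℕ → ℕ → ℕ → ℕ → Set
  Connected S n = Star (Adj S n)

  PathComponent : List ℕ → ℕ → ℕ → Set
  PathComponent S n i =
    ∃ λ k → Connected S n i k × ∃ λ j → j ∈ indices × j ∉ S × CommonNeg n k j

  -- c_n = c : the number of n-path components equals c, witnessed by a
  -- list of c representatives, one from each n-path component.
  PathCount : List ℕ → ℕ → ℕ → Set
  PathCount S n c = ∃ λ (reps : List ℕ) →
      length reps ≡ c
    × All (λ r → r ∈ S × PathComponent S n r) reps
    × AllPairs (λ a b → ¬ Connected S n a b) reps
    × (∀ i → i ∈ S → PathComponent S n i → Any (Connected S n i) reps)

module Submission where

-- Write π j for the index of g_n g_j. Row n of N_i has entries δ_i(g_j) δ_i(g_n g_j),
-- so it is -1 exactly in the columns i and π⁻¹ i when these differ, and N_a, N_b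
-- share a -1 in row n iff b = π a or a = π b. As π permutes the indices, the
-- components of the graph are the maximal runs a, π a, π² a, … inside S and the
-- π-cycles contained in S; the n-paths are the runs, each containing exactly one exit
-- a ∈ S with π a ∉ S. Hence c_n is the number E of exits.
--
-- Up to the factor ∏_{i∈S} δ_i(g_n), entry (n, j) of M is (-1)^([j∈S] + [π j∈S]) R_nj.
-- Classifying columns by [j ∈ S], [π j ∈ S] and R_nj, and using
-- Σ_j [π j ∈ S] = Σ_j [j ∈ S], gives
--   (row sum) = ± (4t + 4 I_n - 4E - 2 #{j : R_nj = -1}).
-- Row n of R = J_t ⊗ A repeats row (n - 1) mod 4 of A t times: for n ≡ 1 (mod 4) it
-- has no -1 (and then I_n = 0), otherwise 2t of them.

open import Defs

open import Data.Bool using (Bool; true; false; _∧_; not)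
open import Data.Empty using (⊥-elim)
open import Data.Fin using (Fin; toℕ)
import Data.Fin.Properties as FinP
open import Data.Integer as ℤ using (ℤ; +_; 0ℤ; 1ℤ; -1ℤ)
import Data.Integer.Properties as ℤP
open import Algebra.Properties.AbelianGroup ℤP.+-0-abelianGroup using (∙-cancelʳ)
open import Algebra.Properties.CommutativeSemigroup ℤP.+-commutativeSemigroup
  using (xy∙z≈xz∙y) renaming (interchange to +-interchange)
open import Algebra.Properties.CommutativeSemigroup ℤP.*-commutativeSemigroup
  using () renaming (interchange to *-interchange)
open import Data.Integer.Tactic.RingSolver using (solve-∀)
open import Data.List using (List; []; _∷_; _++_; map; foldr; filter; length; lookup; upTo; applyUpTo)
import Data.List.Properties as List
open import Data.Nat as ℕ using (ℕ; zero; suc; _≤_; _<_; s≤s; z≤n; NonZero)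
open import Data.List.Membership.DecPropositional ℕ._≟_ using (_∈?_)
open import Data.List.Membership.Propositional using (_∈_; _∉_; lose; find)
open import Data.List.Membership.Propositional.Properties
  using (∈-map⁺; ∈-map⁻; ∈-upTo⁺; ∈-upTo⁻; ∈-filter⁺; ∈-filter⁻)
open import Data.List.Membership.Propositional.Properties.WithK using (unique∧set⇒bag)
open import Data.List.Relation.Binary.BagAndSetEquality using (∼bag⇒↭)
open import Data.List.Relation.Binary.Permutation.Propositional using (_↭_; ↭⇒↭ₛ)
import Data.List.Relation.Binary.Permutation.Propositional.Properties as Perm
open import Data.List.Relation.Binary.Permutation.Setoid.Properties ℤP.≡-setoid using (foldr-commMonoid)
open import Data.List.Relation.Binary.Pointwise using (Pointwise; []; _∷_; Pointwise-length)
open import Data.List.Relation.Unary.All as All using (All; []; _∷_)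
import Data.List.Relation.Unary.All.Properties as AllP
open import Data.List.Relation.Unary.AllPairs using (AllPairs; []; _∷_)
open import Data.List.Relation.Unary.Any using (Any; here; there; index)
open import Data.List.Relation.Unary.Any.Properties using (lookup-index)
open import Data.List.Relation.Unary.Unique.Propositional using (Unique)
import Data.List.Relation.Unary.Unique.Propositional.Properties as Unique
import Data.Nat.Properties as ℕP
open import Data.Nat.DivMod
open import Data.Nat.Divisibility using (∣-refl)
open import Data.Nat.GeneralisedArithmetic using (iterate; iterate-is-fold)
open import Data.Product using (∃; _×_; _,_; proj₁; proj₂)
open import Data.Sum as Sum using (_⊎_; inj₁; inj₂; [_,_]′)
open import Function using (_∘_; _∘′_; id)
open import Function.Bundles using (_⇔_; mk⇔; Equivalence)
open import Function.Construct.Composition using (_⇔-∘_)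
open import Relation.Binary.Construct.Closure.ReflexiveTransitive as Star using (ε; _◅_; _◅◅_)
open import Relation.Binary.PropositionalEquality
open import Relation.Nullary using (¬_; Dec; does; yes; no)
open import Relation.Nullary.Decidable using (_×-dec_; ¬?; dec-true; dec-false; does-⇔)
open import Relation.Unary using (Pred; Decidable)

module ListSums where

  open import Data.Integer using (_+_; _*_)

  ∑ : List ℤ → ℤ
  ∑ = foldr _+_ 0ℤ

  ∏ : List ℤ → ℤ
  ∏ = foldr _*_ 1ℤ

  indicator : Bool → ℤ
  indicator true = 1ℤ
  indicator false = 0ℤ

  ∑-↭ : ∀ {xs ys} → xs ↭ ys → ∑ xs ≡ ∑ ys
  ∑-↭ p = foldr-commMonoid ℤP.+-0-isCommutativeMonoid (↭⇒↭ₛ p)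

  ∑-++ : ∀ xs ys → ∑ (xs ++ ys) ≡ ∑ xs + ∑ ys
  ∑-++ [] ys = sym (ℤP.+-identityˡ (∑ ys))
  ∑-++ (x ∷ xs) ys = trans (cong (_+_ x) (∑-++ xs ys)) (sym (ℤP.+-assoc x (∑ xs) (∑ ys)))

  module _ {X : Set} where

    ∑-map-cong : ∀ {f g : X → ℤ} xs → (∀ x → f x ≡ g x) → ∑ (map f xs) ≡ ∑ (map g xs)
    ∑-map-cong [] _ = refl
    ∑-map-cong (x ∷ xs) f≗g = cong₂ _+_ (f≗g x) (∑-map-cong xs f≗g)

    ∑-map-+ : ∀ (f g : X → ℤ) xs → ∑ (map (λ x → f x + g x) xs) ≡ ∑ (map f xs) + ∑ (map g xs)
    ∑-map-+ f g [] = refl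
    ∑-map-+ f g (x ∷ xs) = trans (cong (_+_ (f x + g x)) (∑-map-+ f g xs)) (+-interchange (f x) (g x) _ _)

    ∑-map-* : ∀ c (f : X → ℤ) xs → ∑ (map (λ x → c * f x) xs) ≡ c * ∑ (map f xs)
    ∑-map-* c f [] = sym (ℤP.*-zeroʳ c)
    ∑-map-* c f (x ∷ xs) = trans (cong (_+_ (c * f x)) (∑-map-* c f xs)) (sym (ℤP.*-distribˡ-+ c (f x) _))

    ∑-map-1 : ∀ (xs : List X) → ∑ (map (λ _ → 1ℤ) xs) ≡ + length xs
    ∑-map-1 [] = refl
    ∑-map-1 (x ∷ xs) = trans (cong (_+_ 1ℤ) (∑-map-1 xs)) (sym (ℤP.pos-+ 1 (length xs)))

    length-filter≡∑-indicator : ∀ {p} {P : Pred X p} (P? : Decidable P) xs →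
      + length (filter P? xs) ≡ ∑ (map (λ x → indicator (does (P? x))) xs)
    length-filter≡∑-indicator P? [] = refl
    length-filter≡∑-indicator P? (x ∷ xs) with does (P? x)
    ... | true = trans (ℤP.pos-+ 1 _) (cong (_+_ 1ℤ) (length-filter≡∑-indicator P? xs))
    ... | false = trans (length-filter≡∑-indicator P? xs) (sym (ℤP.+-identityˡ _))

    ∏-map-* : ∀ (f g : X → ℤ) xs → ∏ (map (λ x → f x * g x) xs) ≡ ∏ (map f xs) * ∏ (map g xs)
    ∏-map-* f g [] = refl
    ∏-map-* f g (x ∷ xs) = trans (cong (_*_ (f x * g x)) (∏-map-* f g xs)) (*-interchange (f x) (g x) _ _)

    ∑-map-+* : ∀ (f : X → ℤ) c g xs → ∑ (map (λ x → f x + c * g x) xs) ≡ ∑ (map f xs) + c * ∑ (map g xs)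
    ∑-map-+* f c g xs = trans (∑-map-+ f (λ x → c * g x) xs) (cong (_+_ (∑ (map f xs))) (∑-map-* c g xs))

    applyUpTo-cong : ∀ {f g : ℕ → X} → (∀ k → f k ≡ g k) → ∀ n → applyUpTo f n ≡ applyUpTo g n
    applyUpTo-cong f≗g zero = refl
    applyUpTo-cong f≗g (suc n) = cong₂ _∷_ (f≗g 0) (applyUpTo-cong (f≗g ∘ suc) n)

    applyUpTo-++ : ∀ (f : ℕ → X) m n → applyUpTo f (m ℕ.+ n) ≡ applyUpTo f m ++ applyUpTo (f ∘ (m ℕ.+_)) n
    applyUpTo-++ f zero n = refl
    applyUpTo-++ f (suc m) n = cong (f 0 ∷_) (applyUpTo-++ (f ∘ suc) m n)

  ∑-applyUpTo-periodic : ∀ (f : ℕ → ℤ) p → (∀ k → f (p ℕ.+ k) ≡ f k) →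
    ∀ m → ∑ (applyUpTo f (m ℕ.* p)) ≡ + m * ∑ (applyUpTo f p)
  ∑-applyUpTo-periodic f p periodic zero = refl
  ∑-applyUpTo-periodic f p periodic (suc m) = begin
    ∑ (applyUpTo f (p ℕ.+ m ℕ.* p))
      ≡⟨ cong ∑ (applyUpTo-++ f p (m ℕ.* p)) ⟩
    ∑ (applyUpTo f p ++ applyUpTo (f ∘ (p ℕ.+_)) (m ℕ.* p))
      ≡⟨ ∑-++ (applyUpTo f p) _ ⟩
    ∑ (applyUpTo f p) + ∑ (applyUpTo (f ∘ (p ℕ.+_)) (m ℕ.* p))
      ≡⟨ cong (_+_ (∑ (applyUpTo f p)) ∘ ∑) (applyUpTo-cong periodic (m ℕ.* p)) ⟩
    ∑ (applyUpTo f p) + ∑ (applyUpTo f (m ℕ.* p))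
      ≡⟨ cong (_+_ (∑ (applyUpTo f p))) (∑-applyUpTo-periodic f p periodic m) ⟩
    ∑ (applyUpTo f p) + + m * ∑ (applyUpTo f p)
      ≡⟨ ℤP.suc-* (+ m) (∑ (applyUpTo f p)) ⟨
    + suc m * ∑ (applyUpTo f p) ∎
    where open ≡-Reasoning

open ListSums

module IndexArithmetic where

  open import Data.Nat using (_+_; _*_; _∸_)

  [m+n%d]%d≡[m+n]%d : ∀ m n d .{{_ : NonZero d}} → (m + n % d) % d ≡ (m + n) % d
  [m+n%d]%d≡[m+n]%d m n d = begin
    (m + n % d) % d           ≡⟨ %-distribˡ-+ m (n % d) d ⟩
    (m % d + n % d % d) % d   ≡⟨ cong (λ z → (m % d + z) % d) (m%n%n≡m%n n d) ⟩
    (m % d + n % d) % d       ≡⟨ %-distribˡ-+ m n d ⟨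
    (m + n) % d               ∎
    where open ≡-Reasoning

  [m%d+n]%d≡[m+n]%d : ∀ m n d .{{_ : NonZero d}} → (m % d + n) % d ≡ (m + n) % d
  [m%d+n]%d≡[m+n]%d m n d = begin
    (m % d + n) % d ≡⟨ cong (_% d) (ℕP.+-comm (m % d) n) ⟩
    (n + m % d) % d ≡⟨ [m+n%d]%d≡[m+n]%d n m d ⟩
    (n + m) % d     ≡⟨ cong (_% d) (ℕP.+-comm n m) ⟩
    (m + n) % d     ∎
    where open ≡-Reasoning

  module _ (t : ℕ) .{{_ : NonZero t}} where

    private
      index-rearrange : ∀ q r → 4 * q + r ≡ r + q * 4
      index-rearrange q r = trans (ℕP.+-comm (4 * q) r) (cong (_+_ r) (ℕP.*-comm 4 q))

      index-pred : ∀ q r → 4 * q + r + 1 ∸ 1 ≡ r + q * 4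
      index-pred q r = trans (ℕP.m+n∸n≡m (4 * q + r) 1) (index-rearrange q r)

    uvPart-index : ∀ q {r} → r < 4 → uvPart t (4 * q + r + 1) ≡ r
    uvPart-index q {r} r<4 = begin
      (4 * q + r + 1 ∸ 1) % 4 ≡⟨ cong (_% 4) (index-pred q r) ⟩
      (r + q * 4) % 4         ≡⟨ [m+kn]%n≡m%n r q 4 ⟩
      r % 4                   ≡⟨ m<n⇒m%n≡m r<4 ⟩
      r                       ∎
      where open ≡-Reasoning

    xPow-index : ∀ q {r} → r < 4 → xPow t (4 * q + r + 1) ≡ q
    xPow-index q {r} r<4 = begin
      (4 * q + r + 1 ∸ 1) / 4 ≡⟨ cong (_/ 4) (index-pred q r) ⟩
      (r + q * 4) / 4         ≡⟨ +-distrib-/ r (q * 4) no-carry ⟩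
      r / 4 + q * 4 / 4       ≡⟨ cong₂ _+_ (m<n⇒m/n≡0 r<4) (m*n/n≡m q 4) ⟩
      q                       ∎
      where
      open ≡-Reasoning
      no-carry : r % 4 + q * 4 % 4 < 4
      no-carry = subst₂ (λ a b → a + b < 4) (sym (m<n⇒m%n≡m r<4)) (sym (m*n%n≡0 q 4))
                        (subst (_< 4) (sym (ℕP.+-identityʳ r)) r<4)

    index-xPow-uvPart : ∀ {j} → 1 ≤ j → 4 * xPow t j + uvPart t j + 1 ≡ j
    index-xPow-uvPart {suc k} _ = begin
      4 * (k / 4) + k % 4 + 1 ≡⟨ cong (_+ 1) (index-rearrange (k / 4) (k % 4)) ⟩
      k % 4 + k / 4 * 4 + 1   ≡⟨ cong (_+ 1) (m≡m%n+[m/n]*n k 4) ⟨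
      k + 1                   ≡⟨ ℕP.+-comm k 1 ⟩
      suc k                   ∎
      where open ≡-Reasoning

    ∈-indices⁺ : ∀ {j} → 1 ≤ j → j ≤ 4 * t → j ∈ indices t
    ∈-indices⁺ {suc k} _ j≤4t = ∈-map⁺ suc (∈-upTo⁺ j≤4t)

    indices-unique : Unique (indices t)
    indices-unique = Unique.map⁺ ℕP.suc-injective (Unique.upTo⁺ (4 * t))

    length-indices : length (indices t) ≡ 4 * t
    length-indices = trans (List.length-map suc (upTo (4 * t))) (List.length-upTo (4 * t))

    ∈-indices⁻ : ∀ {j} → j ∈ indices t → 1 ≤ j × j ≤ 4 * t
    ∈-indices⁻ j∈ with ∈-map⁻ suc j∈
    ... | k , k∈ , refl = s≤s z≤n , ∈-upTo⁻ k∈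

    index-∈-indices : ∀ {q r} → q < t → r < 4 → 4 * q + r + 1 ∈ indices t
    index-∈-indices {q} {r} q<t r<4 = ∈-indices⁺ (ℕP.m≤n+m 1 (4 * q + r)) (begin
      4 * q + r + 1   ≡⟨ ℕP.+-comm (4 * q + r) 1 ⟩
      suc (4 * q + r) ≤⟨ ℕP.+-monoʳ-< (4 * q) r<4 ⟩
      4 * q + 4       ≡⟨ trans (ℕP.+-comm (4 * q) 4) (sym (ℕP.*-suc 4 q)) ⟩
      4 * suc q       ≤⟨ ℕP.*-monoʳ-≤ 4 q<t ⟩
      4 * t           ∎)
      where open ℕP.≤-Reasoning

    xPow<t : ∀ {j} → j ∈ indices t → xPow t j < t
    xPow<t j∈ with ∈-map⁻ suc j∈
    ... | k , k∈ , refl = m<n*o⇒m/o<n (subst (k <_) (ℕP.*-comm 4 t) (∈-upTo⁻ k∈))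

    uvPart<4 : ∀ j → uvPart t j < 4
    uvPart<4 j = m%n<n (j ∸ 1) 4

    xor4<4 : ∀ a b → xor4 t a b < 4
    xor4<4 a b = s≤s (ℕP.+-mono-≤ (bit (a % 2 + b % 2)) (ℕP.*-monoʳ-≤ 2 (bit (a / 2 + b / 2))))
      where
      bit : ∀ m → m % 2 ≤ 1
      bit m = ℕP.≤-pred (m%n<n m 2)

    xor4-involutive : ∀ {a b} → a < 4 → b < 4 → xor4 t a (xor4 t a b) ≡ b
    xor4-involutive {0} {0} _ _ = refl
    xor4-involutive {0} {1} _ _ = refl
    xor4-involutive {0} {2} _ _ = refl
    xor4-involutive {0} {3} _ _ = refl
    xor4-involutive {1} {0} _ _ = refl
    xor4-involutive {1} {1} _ _ = refl
    xor4-involutive {1} {2} _ _ = refl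
    xor4-involutive {1} {3} _ _ = refl
    xor4-involutive {2} {0} _ _ = refl
    xor4-involutive {2} {1} _ _ = refl
    xor4-involutive {2} {2} _ _ = refl
    xor4-involutive {2} {3} _ _ = refl
    xor4-involutive {3} {0} _ _ = refl
    xor4-involutive {3} {1} _ _ = refl
    xor4-involutive {3} {2} _ _ = refl
    xor4-involutive {3} {3} _ _ = refl
    xor4-involutive {suc (suc (suc (suc _)))} (s≤s (s≤s (s≤s (s≤s ())))) _
    xor4-involutive {_} {suc (suc (suc (suc _)))} _ (s≤s (s≤s (s≤s (s≤s ()))))

    xPow-mul : ∀ s j → xPow t (mul t s j) ≡ (xPow t s + xPow t j) % t
    xPow-mul s j = xPow-index ((xPow t s + xPow t j) % t) (xor4<4 (uvPart t s) (uvPart t j))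

    uvPart-mul : ∀ s j → uvPart t (mul t s j) ≡ xor4 t (uvPart t s) (uvPart t j)
    uvPart-mul s j = uvPart-index ((xPow t s + xPow t j) % t) (xor4<4 (uvPart t s) (uvPart t j))

    mul-∈-indices : ∀ s j → mul t s j ∈ indices t
    mul-∈-indices s j = index-∈-indices (m%n<n _ t) (xor4<4 (uvPart t s) (uvPart t j))

    mul-cancel : ∀ a b {j} → j ∈ indices t → (xPow t a + xPow t b) % t ≡ 0 → uvPart t a ≡ uvPart t b →
      mul t a (mul t b j) ≡ j
    mul-cancel a b {j} j∈ xa+xb≡0 ua≡ub = begin
      mul t a (mul t b j)
        ≡⟨ cong₂ (λ x u → 4 * ((xa + x) % t) + xor4 t ua u + 1) (xPow-mul b j) (uvPart-mul b j) ⟩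
      4 * ((xa + (xb + xj) % t) % t) + xor4 t ua (xor4 t ub uj) + 1
        ≡⟨ cong₂ (λ x u → 4 * x + u + 1) x-part u-part ⟩
      4 * xj + uj + 1
        ≡⟨ index-xPow-uvPart (proj₁ (∈-indices⁻ j∈)) ⟩
      j ∎
      where
      open ≡-Reasoning
      xa = xPow t a
      xb = xPow t b
      xj = xPow t j
      ua = uvPart t a
      ub = uvPart t b
      uj = uvPart t j
      x-part : (xa + (xb + xj) % t) % t ≡ xj
      x-part = begin
        (xa + (xb + xj) % t) % t ≡⟨ [m+n%d]%d≡[m+n]%d xa (xb + xj) t ⟩
        (xa + (xb + xj)) % t     ≡⟨ cong (_% t) (ℕP.+-assoc xa xb xj) ⟨
        (xa + xb + xj) % t       ≡⟨ [m%d+n]%d≡[m+n]%d (xa + xb) xj t ⟨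
        ((xa + xb) % t + xj) % t ≡⟨ cong (λ z → (z + xj) % t) xa+xb≡0 ⟩
        xj % t                   ≡⟨ m<n⇒m%n≡m (xPow<t j∈) ⟩
        xj                       ∎
      u-part : xor4 t ua (xor4 t ub uj) ≡ uj
      u-part = trans (cong (λ u → xor4 t ua (xor4 t u uj)) (sym ua≡ub))
                     (xor4-involutive (uvPart<4 a) (uvPart<4 j))

    inv : ℕ → ℕ
    inv n = 4 * ((t ∸ xPow t n) % t) + uvPart t n + 1

    private
      xPow-inv+xPow : ∀ {n} → n ∈ indices t → (xPow t (inv n) + xPow t n) % t ≡ 0
      xPow-inv+xPow {n} n∈ = begin
        (xPow t (inv n) + xPow t n) % t     ≡⟨ cong (λ x → (x + xPow t n) % t)
                                                     (xPow-index ((t ∸ xPow t n) % t) (uvPart<4 n)) ⟩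
        ((t ∸ xPow t n) % t + xPow t n) % t ≡⟨ [m%d+n]%d≡[m+n]%d (t ∸ xPow t n) (xPow t n) t ⟩
        (t ∸ xPow t n + xPow t n) % t       ≡⟨ cong (_% t) (ℕP.m∸n+n≡m (ℕP.<⇒≤ (xPow<t n∈))) ⟩
        t % t                               ≡⟨ n%n≡0 t ⟩
        0                                   ∎
        where open ≡-Reasoning

      uvPart-inv : ∀ n → uvPart t (inv n) ≡ uvPart t n
      uvPart-inv n = uvPart-index ((t ∸ xPow t n) % t) (uvPart<4 n)

    mul-inv-cancelˡ : ∀ {n j} → n ∈ indices t → j ∈ indices t → mul t (inv n) (mul t n j) ≡ j
    mul-inv-cancelˡ {n} n∈ j∈ = mul-cancel (inv n) n j∈ (xPow-inv+xPow n∈) (uvPart-inv n)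

    mul-inv-cancelʳ : ∀ {n j} → n ∈ indices t → j ∈ indices t → mul t n (mul t (inv n) j) ≡ j
    mul-inv-cancelʳ {n} n∈ j∈ = mul-cancel n (inv n) j∈
      (trans (cong (_% t) (ℕP.+-comm (xPow t n) _)) (xPow-inv+xPow n∈)) (sym (uvPart-inv n))

    %4≡1⇔uvPart≡0 : ∀ {j} → 1 ≤ j → j % 4 ≡ 1 ⇔ uvPart t j ≡ 0
    %4≡1⇔uvPart≡0 {suc m} _ =
      subst (λ k → k ≡ 1 ⇔ m % 4 ≡ 0) ([m+n%d]%d≡[m+n]%d 1 m 4) (by-residue (m%n<n m 4))
      where
      by-residue : ∀ {r} → r < 4 → suc r % 4 ≡ 1 ⇔ r ≡ 0
      by-residue {0} _ = mk⇔ (λ _ → refl) (λ _ → refl)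
      by-residue {1} _ = mk⇔ (λ ()) (λ ())
      by-residue {2} _ = mk⇔ (λ ()) (λ ())
      by-residue {3} _ = mk⇔ (λ ()) (λ ())
      by-residue {suc (suc (suc (suc _)))} (s≤s (s≤s (s≤s (s≤s ()))))

    ∑-indices-uvPart : ∀ (f : ℕ → ℤ) → ∑ (map (f ∘ uvPart t) (indices t)) ≡ + t ℤ.* ∑ (map f (upTo 4))
    ∑-indices-uvPart f = begin
      ∑ (map (f ∘ uvPart t) (map suc (upTo (4 * t)))) ≡⟨ cong ∑ (List.map-∘ (upTo (4 * t))) ⟨
      ∑ (map g (upTo (4 * t)))                        ≡⟨ cong ∑ (List.map-upTo g (4 * t)) ⟩
      ∑ (applyUpTo g (4 * t))                         ≡⟨ cong (∑ ∘ applyUpTo g) (ℕP.*-comm 4 t) ⟩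
      ∑ (applyUpTo g (t * 4))                         ≡⟨ ∑-applyUpTo-periodic g 4 period t ⟩
      + t ℤ.* ∑ (map f (upTo 4))                      ∎
      where
      open ≡-Reasoning
      g : ℕ → ℤ
      g k = f (k % 4)
      period : ∀ k → g (4 + k) ≡ g k
      period k = cong f (%-remove-+ˡ k ∣-refl)
open IndexArithmetic

module _ {X : Set} (f : X → X) where

  open import Data.Nat using (_+_; _∸_)

  iterate-suc : ∀ x k → iterate f x (suc k) ≡ f (iterate f x k)
  iterate-suc x k = trans (sym (iterate-is-fold x f (suc k))) (cong f (iterate-is-fold x f k))

  module _ {xs : List X} (f-∈ : ∀ {x} → x ∈ xs → f x ∈ xs)
           (f-injective : ∀ {x y} → x ∈ xs → y ∈ xs → f x ≡ f y → x ≡ y) where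

    iterate-∈ : ∀ {x} → x ∈ xs → ∀ k → iterate f x k ∈ xs
    iterate-∈ x∈ zero = x∈
    iterate-∈ x∈ (suc k) = iterate-∈ (f-∈ x∈) k

    iterate-cancel : ∀ {x} → x ∈ xs → ∀ a d → iterate f x a ≡ iterate f x (a + d) → x ≡ iterate f x d
    iterate-cancel x∈ zero d eq = eq
    iterate-cancel {x} x∈ (suc a) d eq =
      f-injective x∈ (iterate-∈ x∈ d) (trans (iterate-cancel (f-∈ x∈) a d eq) (iterate-suc x d))

    orbit-position : ∀ {x} → x ∈ xs → Fin (suc (length xs)) → Fin (length xs)
    orbit-position x∈ k = index (iterate-∈ x∈ (toℕ k))

    -- Two of the first 1 + length xs iterates coincide (pigeonhole); cancel the common prefix.
    iterate-periodic : ∀ {x} → x ∈ xs → ∃ λ d → iterate f x (suc d) ≡ x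
    iterate-periodic {x} x∈ with FinP.pigeonhole (ℕP.n<1+n (length xs)) (orbit-position x∈)
    ... | i , j , i<j , same = toℕ j ∸ suc (toℕ i) , sym (iterate-cancel x∈ (toℕ i) _ coincide)
      where
      coincide : iterate f x (toℕ i) ≡ iterate f x (toℕ i + suc (toℕ j ∸ suc (toℕ i)))
      coincide = begin
        iterate f x (toℕ i)                               ≡⟨ lookup-index (iterate-∈ x∈ (toℕ i)) ⟩
        lookup xs (orbit-position x∈ i)                   ≡⟨ cong (lookup xs) same ⟩
        lookup xs (orbit-position x∈ j)                   ≡⟨ lookup-index (iterate-∈ x∈ (toℕ j)) ⟨
        iterate f x (toℕ j)                               ≡⟨ cong (iterate f x) (ℕP.m+[n∸m]≡n i<j) ⟨
        iterate f x (suc (toℕ i) + (toℕ j ∸ suc (toℕ i))) ≡⟨ cong (iterate f x) (ℕP.+-suc (toℕ i) _) ⟨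
        iterate f x (toℕ i + suc (toℕ j ∸ suc (toℕ i)))   ∎
        where open ≡-Reasoning

    map-↭ : Unique xs → (∀ {y} → y ∈ xs → ∃ λ x → x ∈ xs × f x ≡ y) → map f xs ↭ xs
    map-↭ xs-unique f-onto = ∼bag⇒↭ (unique∧set⇒bag (map⁺-unique id xs-unique) xs-unique (mk⇔ into onto))
      where
      map⁺-unique : ∀ {ys} → (∀ {y} → y ∈ ys → y ∈ xs) → Unique ys → Unique (map f ys)
      map⁺-unique {[]} _ [] = []
      map⁺-unique {y ∷ ys} ys⊆xs (y∉ys ∷ ys-unique) =
        AllP.map⁺ (All.tabulate λ z∈ fy≡fz →
          All.lookup y∉ys z∈ (f-injective (ys⊆xs (here refl)) (ys⊆xs (there z∈)) fy≡fz))
        ∷ map⁺-unique (ys⊆xs ∘ there) ys-unique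
      into : ∀ {y} → y ∈ map f xs → y ∈ xs
      into y∈ with ∈-map⁻ f y∈
      ... | x , x∈ , refl = f-∈ x∈
      onto : ∀ {y} → y ∈ xs → y ∈ map f xs
      onto y∈ with f-onto y∈
      ... | x , x∈ , refl = ∈-map⁺ f x∈

-- If every class meeting Q contains exactly one canonical element, then the
-- number of classes meeting Q is the number of canonical elements.
module CanonicalRepresentatives
  {X : Set} (_~_ : X → X → Set)
  (~-sym : ∀ {a b} → a ~ b → b ~ a) (~-trans : ∀ {a b c} → a ~ b → b ~ c → a ~ c)
  (Q Canonical : X → Set)
  (canonical⇒Q : ∀ {a} → Canonical a → Q a)
  (Q⇒canonical : ∀ {a} → Q a → ∃ λ e → Canonical e × a ~ e)
  (canonical-unique : ∀ {a b} → Canonical a → Canonical b → a ~ b → a ≡ b)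
  (canonicals : List X) (canonicals-unique : Unique canonicals)
  (∈-canonicals : ∀ {a} → a ∈ canonicals ⇔ Canonical a)
  where

  ClassCount : ℕ → Set
  ClassCount c = ∃ λ reps → length reps ≡ c × All Q reps × AllPairs (λ a b → ¬ a ~ b) reps
    × (∀ a → Q a → Any (a ~_) reps)

  private
    canonical⁺ : ∀ {a} → a ∈ canonicals → Canonical a
    canonical⁺ = Equivalence.to ∈-canonicals

    canonical⁻ : ∀ {a} → Canonical a → a ∈ canonicals
    canonical⁻ = Equivalence.from ∈-canonicals

    canonicals-inequivalent : ∀ {es} → All Canonical es → Unique es → AllPairs (λ a b → ¬ a ~ b) es
    canonicals-inequivalent [] [] = []
    canonicals-inequivalent (c ∷ cs) (u ∷ us) =
      All.zipWith (λ (c′ , a≢b) a~b → a≢b (canonical-unique c c′ a~b)) (cs , u)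
      ∷ canonicals-inequivalent cs us

    CanonicalOf : X → X → Set
    CanonicalOf r e = Canonical e × r ~ e

    canonicalsOf : ∀ {reps} → All Q reps → ∃ (Pointwise CanonicalOf reps)
    canonicalsOf [] = [] , []
    canonicalsOf (q ∷ qs) with Q⇒canonical q | canonicalsOf qs
    ... | e , ce | es , pw = e ∷ es , ce ∷ pw

    canonicalsOf-unique : ∀ {reps es} → Pointwise CanonicalOf reps es → AllPairs (λ a b → ¬ a ~ b) reps → Unique es
    canonicalsOf-unique [] [] = []
    canonicalsOf-unique ((_ , r~e) ∷ pw) (r≁ ∷ pairs) = distinct pw r≁ ∷ canonicalsOf-unique pw pairs
      where
      distinct : ∀ {rs es} → Pointwise CanonicalOf rs es → All (λ r′ → ¬ _ ~ r′) rs → All (λ e′ → ¬ _ ≡ e′) es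
      distinct [] [] = []
      distinct ((_ , r′~e′) ∷ pw) (≁ ∷ ≁s) = (λ { refl → ≁ (~-trans r~e (~-sym r′~e′)) }) ∷ distinct pw ≁s

    canonicalsOf-canonical : ∀ {reps es e} → Pointwise CanonicalOf reps es → e ∈ es → Canonical e
    canonicalsOf-canonical ((ce , _) ∷ _) (here refl) = ce
    canonicalsOf-canonical (_ ∷ pw) (there e∈) = canonicalsOf-canonical pw e∈

    canonicalsOf-∈ : ∀ {reps es r} → Pointwise CanonicalOf reps es → r ∈ reps → ∃ λ e → e ∈ es × CanonicalOf r e
    canonicalsOf-∈ (ce ∷ _) (here refl) = _ , here refl , ce
    canonicalsOf-∈ (_ ∷ pw) (there r∈) with canonicalsOf-∈ pw r∈
    ... | e , e∈ , ce = e , there e∈ , ce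

  classCount⇔ : ∀ c → length canonicals ≡ c ⇔ ClassCount c
  classCount⇔ c = mk⇔ from to
    where
    to : ClassCount c → length canonicals ≡ c
    to (reps , refl , qs , pairs , cover) = sym (trans (Pointwise-length pw) (Perm.↭-length es↭canonicals))
      where
      es = proj₁ (canonicalsOf qs)
      pw = proj₂ (canonicalsOf qs)
      canonical∈es : ∀ {e} → e ∈ canonicals → e ∈ es
      canonical∈es {e} e∈ with find (cover e (canonical⇒Q (canonical⁺ e∈)))
      ... | r , r∈ , e~r with canonicalsOf-∈ pw r∈
      ... | e′ , e′∈ , (ce′ , r~e′) =
        subst (_∈ es) (sym (canonical-unique (canonical⁺ e∈) ce′ (~-trans e~r r~e′))) e′∈
      es↭canonicals = ∼bag⇒↭ (unique∧set⇒bag (canonicalsOf-unique pw pairs) canonicals-unique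
        (mk⇔ (canonical⁻ ∘′ canonicalsOf-canonical pw) canonical∈es))
    from : length canonicals ≡ c → ClassCount c
    from refl = canonicals , refl
      , All.tabulate (canonical⇒Q ∘′ canonical⁺)
      , canonicals-inequivalent (All.tabulate canonical⁺) canonicals-unique
      , λ a q → let (e , ce , a~e) = Q⇒canonical q in lose (canonical⁻ ce) a~e

module Signs where

  open import Data.Integer using (_+_; _*_)

  sign : Bool → ℤ
  sign true = -1ℤ
  sign false = 1ℤ

  δ-self : ∀ t .{{_ : NonZero t}} i → δ t i i ≡ -1ℤ
  δ-self t i with i ℕ.≟ i
  ... | yes _ = refl
  ... | no i≢i = ⊥-elim (i≢i refl)

  δ-other : ∀ t .{{_ : NonZero t}} {i k} → k ≢ i → δ t i k ≡ 1ℤ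
  δ-other t {i} {k} k≢i with k ℕ.≟ i
  ... | yes k≡i = ⊥-elim (k≢i k≡i)
  ... | no _ = refl

  δ≡-1⇒≡ : ∀ t .{{_ : NonZero t}} {i k} → δ t i k ≡ -1ℤ → k ≡ i
  δ≡-1⇒≡ t {i} {k} δ≡-1 with k ℕ.≟ i
  ... | yes k≡i = k≡i
  δ≡-1⇒≡ t () | no _

  module _ (t : ℕ) .{{_ : NonZero t}} where

    ∏-δ : ∀ j {T} → Unique T → ∏ (map (λ i → δ t i j) T) ≡ sign (does (j ∈? T))
    ∏-δ j {[]} [] = refl
    ∏-δ j {i ∷ T} (i∉T ∷ T-unique) = byCases (j ℕ.≟ i)
      where
      open ≡-Reasoning
      byCases : Dec (j ≡ i) → δ t i j * ∏ (map (λ i → δ t i j) T) ≡ sign (does (j ∈? (i ∷ T)))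
      byCases (yes refl) = begin
        δ t j j * ∏ (map (λ i → δ t i j) T) ≡⟨ cong₂ _*_ (δ-self t j) (∏-δ j T-unique) ⟩
        -1ℤ * sign (does (j ∈? T))          ≡⟨ cong (λ b → -1ℤ * sign b)
                                                    (dec-false (j ∈? T) (AllP.All¬⇒¬Any i∉T)) ⟩
        -1ℤ                                 ≡⟨ cong sign (dec-true (j ∈? (j ∷ T)) (here refl)) ⟨
        sign (does (j ∈? (j ∷ T)))          ∎
      byCases (no j≢i) = begin
        δ t i j * ∏ (map (λ i → δ t i j) T) ≡⟨ cong₂ _*_ (δ-other t j≢i) (∏-δ j T-unique) ⟩
        1ℤ * sign (does (j ∈? T))           ≡⟨ ℤP.*-identityˡ _ ⟩
        sign (does (j ∈? T))                ≡⟨ cong sign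
                                                    (does-⇔ (mk⇔ there ∈-tail) (j ∈? T) (j ∈? (i ∷ T))) ⟩
        sign (does (j ∈? (i ∷ T)))          ∎
        where
        ∈-tail : j ∈ i ∷ T → j ∈ T
        ∈-tail (here j≡i) = ⊥-elim (j≢i j≡i)
        ∈-tail (there j∈T) = j∈T

    A≡±1 : ∀ r k → A t r k ≡ 1ℤ ⊎ A t r k ≡ -1ℤ
    A≡±1 0 _ = inj₁ refl
    A≡±1 1 0 = inj₁ refl
    A≡±1 1 1 = inj₂ refl
    A≡±1 1 2 = inj₁ refl
    A≡±1 1 (suc (suc (suc _))) = inj₂ refl
    A≡±1 2 0 = inj₁ refl
    A≡±1 2 1 = inj₂ refl
    A≡±1 2 2 = inj₂ refl
    A≡±1 2 (suc (suc (suc _))) = inj₁ refl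
    A≡±1 (suc (suc (suc _))) 0 = inj₁ refl
    A≡±1 (suc (suc (suc _))) 1 = inj₁ refl
    A≡±1 (suc (suc (suc _))) (suc (suc _)) = inj₂ refl

    A-negatives : ℕ → ℤ
    A-negatives r = ∑ (map (λ k → indicator (does (A t r k ℤ.≟ -1ℤ))) (upTo 4))

    A-negatives≡2 : ∀ {r} → r < 4 → r ≢ 0 → A-negatives r ≡ + 2
    A-negatives≡2 {0} _ r≢0 = ⊥-elim (r≢0 refl)
    A-negatives≡2 {1} _ _ = refl
    A-negatives≡2 {2} _ _ = refl
    A-negatives≡2 {3} _ _ = refl
    A-negatives≡2 {suc (suc (suc (suc _)))} (s≤s (s≤s (s≤s (s≤s ())))) _

  -- Column j of row n, with a = [j ∈ S], b = [π j ∈ S], ρ = R_nj and N = (∘ N_i)_nj.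
  column-identity : ∀ a b {ρ N} → N ≡ sign a * sign b → ρ ≡ 1ℤ ⊎ ρ ≡ -1ℤ →
    N * ρ + + 4 * indicator (a ∧ not b) + + 2 * indicator b + + 2 * indicator (does (ρ ℤ.≟ -1ℤ))
      ≡ 1ℤ + + 2 * indicator a + + 4 * indicator (does ((ρ ℤ.≟ -1ℤ) ×-dec (N ℤ.≟ -1ℤ)))
  column-identity true  true  refl (inj₁ refl) = refl
  column-identity true  false refl (inj₁ refl) = refl
  column-identity false true  refl (inj₁ refl) = refl
  column-identity false false refl (inj₁ refl) = refl
  column-identity true  true  refl (inj₂ refl) = refl
  column-identity true  false refl (inj₂ refl) = refl
  column-identity false true  refl (inj₂ refl) = refl
  column-identity false false refl (inj₂ refl) = refl

  s+4e≡4x⇒[s≡0⇔e≡x] : ∀ s (e x : ℕ) → s + + 4 * + e ≡ + 4 * + x → (s ≡ 0ℤ ⇔ e ≡ x)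
  s+4e≡4x⇒[s≡0⇔e≡x] s e x eq = mk⇔ to from
    where
    to : s ≡ 0ℤ → e ≡ x
    to refl = ℤP.+-injective (ℤP.*-cancelˡ-≡ (+ 4) (+ e) (+ x) (trans (sym (ℤP.+-identityˡ _)) eq))
    from : e ≡ x → s ≡ 0ℤ
    from refl = ∙-cancelʳ (+ 4 * + e) s 0ℤ (trans eq (sym (ℤP.+-identityˡ _)))

open Signs

module Components (t : ℕ) .{{_ : NonZero t}} (S : List ℕ) (n : ℕ)
                  (n∈ : n ∈ indices t) (S⊆ : All (_∈ indices t) S) where

  π : ℕ → ℕ
  π = mul t n

  π-∈ : ∀ {j} → j ∈ indices t → π j ∈ indices t
  π-∈ {j} _ = mul-∈-indices t n j

  π-injective : ∀ {v w} → v ∈ indices t → w ∈ indices t → π v ≡ π w → v ≡ w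
  π-injective {v} {w} v∈ w∈ πv≡πw = begin
    v                       ≡⟨ mul-inv-cancelˡ t n∈ v∈ ⟨
    mul t (inv t n) (π v)   ≡⟨ cong (mul t (inv t n)) πv≡πw ⟩
    mul t (inv t n) (π w)   ≡⟨ mul-inv-cancelˡ t n∈ w∈ ⟩
    w                       ∎
    where open ≡-Reasoning

  π-onto : ∀ {y} → y ∈ indices t → ∃ λ x → x ∈ indices t × π x ≡ y
  π-onto {y} y∈ = mul t (inv t n) y , mul-∈-indices t (inv t n) y , mul-inv-cancelʳ t n∈ y∈

  map-π↭indices : map π (indices t) ↭ indices t
  map-π↭indices = map-↭ π π-∈ π-injective (indices-unique t) π-onto

  S⊆indices : ∀ {i} → i ∈ S → i ∈ indices t
  S⊆indices = All.lookup S⊆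

  Nδ≡-1⇒ : ∀ {i j} → Nδ t i n j ≡ -1ℤ → j ≡ i ⊎ π j ≡ i
  Nδ≡-1⇒ {i} {j} N≡-1 with j ℕ.≟ i
  ... | yes j≡i = inj₁ j≡i
  ... | no _ = inj₂ (δ≡-1⇒≡ t (trans (sym (ℤP.*-identityˡ _)) N≡-1))

  commonNeg-cases : ∀ {a b} → CommonNeg t n a b → a ≡ b ⊎ b ≡ π a ⊎ a ≡ π b
  commonNeg-cases {a} {b} (j , _ , Na≡-1 , Nb≡-1) with Nδ≡-1⇒ {a} {j} Na≡-1 | Nδ≡-1⇒ {b} {j} Nb≡-1
  ... | inj₁ refl | inj₁ refl = inj₁ refl
  ... | inj₁ refl | inj₂ refl = inj₂ (inj₁ refl)
  ... | inj₂ refl | inj₁ refl = inj₂ (inj₂ refl)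
  ... | inj₂ refl | inj₂ refl = inj₁ refl

  commonNeg-π : ∀ {a} → a ∈ indices t → π a ≢ a → CommonNeg t n a (π a)
  commonNeg-π {a} a∈ πa≢a = a , a∈
    , cong₂ ℤ._*_ (δ-self t a) (δ-other t πa≢a)
    , cong₂ ℤ._*_ (δ-other t (πa≢a ∘ sym)) (δ-self t (π a))

  connected-sym : ∀ {a b} → Connected t S n a b → Connected t S n b a
  connected-sym = Star.reverse λ (a∈ , b∈ , j , j∈ , Na , Nb) → b∈ , a∈ , j , j∈ , Nb , Na

  connected-∈ : ∀ {a b} → a ∈ S → Connected t S n a b → b ∈ S
  connected-∈ a∈ ε = a∈
  connected-∈ _ ((_ , b∈ , _) ◅ path) = connected-∈ b∈ path

  connected-π : ∀ {a} → a ∈ S → π a ∈ S → Connected t S n a (π a)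
  connected-π {a} a∈ πa∈ with π a ℕ.≟ a
  ... | yes πa≡a = subst (Connected t S n a) (sym πa≡a) ε
  ... | no πa≢a = (a∈ , πa∈ , commonNeg-π (S⊆indices a∈) πa≢a) ◅ ε

  Exit : ℕ → Set
  Exit a = a ∈ S × π a ∉ S

  ReachesExit : ℕ → ℕ → Set
  ReachesExit a v = ∃ λ k → iterate π v k ≡ a × (∀ i → i ≤ k → iterate π v i ∈ S)

  reachesExit-step : ∀ {a v w} → Exit a → ReachesExit a v → Adj t S n v w → ReachesExit a w
  reachesExit-step {a} {v} {w} exit (k , reach , stays) adj@(_ , w∈ , common) with commonNeg-cases common
  ... | inj₁ refl = k , reach , stays
  ... | inj₂ (inj₂ refl) = suc k , reach , λ { zero _ → w∈ ; (suc i) (s≤s i≤k) → stays i i≤k }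
  ... | inj₂ (inj₁ refl) with k
  ...   | zero = ⊥-elim (proj₂ exit (subst (λ x → π x ∈ S) reach w∈))
  ...   | suc k′ = k′ , reach , λ i i≤k′ → stays (suc i) (s≤s i≤k′)

  reachesExit-path : ∀ {a v w} → Exit a → ReachesExit a v → Connected t S n v w → ReachesExit a w
  reachesExit-path exit reach ε = reach
  reachesExit-path exit reach (adj ◅ path) = reachesExit-path exit (reachesExit-step exit reach adj) path

  -- Reaching the exit a along π inside S is invariant along edges, and from
  -- any other exit b the first step π b already leaves S.
  exit-unique : ∀ {a b} → Exit a → Exit b → Connected t S n a b → a ≡ b
  exit-unique exitA exitB path with reachesExit-path exitA (0 , refl , λ { zero _ → proj₁ exitA }) path
  ... | zero , reach , _ = sym reach
  ... | suc _ , _ , stays = ⊥-elim (proj₂ exitB (stays 1 (s≤s z≤n)))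

  exit-or-iterate-∈ : ∀ fuel {v} → v ∈ S → (∃ λ e → Exit e × Connected t S n v e) ⊎ iterate π v fuel ∈ S
  exit-or-iterate-∈ zero v∈ = inj₂ v∈
  exit-or-iterate-∈ (suc fuel) {v} v∈ with π v ∈? S
  ... | no πv∉ = inj₁ (v , (v∈ , πv∉) , ε)
  ... | yes πv∈ = Sum.map₁ (λ (e , exit , path) → e , exit , connected-π v∈ πv∈ ◅◅ path)
                           (exit-or-iterate-∈ fuel πv∈)

  -- Entering S at π j, the π-cycle through π j must leave S again before returning to j.
  entry⇒exit : ∀ {j} → j ∈ indices t → j ∉ S → π j ∈ S → ∃ λ e → Exit e × Connected t S n (π j) e
  entry⇒exit {j} j∈ j∉ πj∈ = search (iterate-periodic π π-∈ π-injective (S⊆indices πj∈))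
    where
    returns : ∀ d → iterate π (π j) (suc d) ≡ π j → iterate π (π j) d ≡ j
    returns d period = π-injective (iterate-∈ π π-∈ π-injective (S⊆indices πj∈) d) j∈
                                   (trans (sym (iterate-suc π (π j) d)) period)
    search : (∃ λ d → iterate π (π j) (suc d) ≡ π j) → ∃ λ e → Exit e × Connected t S n (π j) e
    search (d , period) =
      [ id , (λ πᵈ⁺¹j∈ → ⊥-elim (j∉ (subst (_∈ S) (returns d period) πᵈ⁺¹j∈))) ]′ (exit-or-iterate-∈ d πj∈)

  exit⇒pathComponent : ∀ {e} → Exit e → PathComponent t S n e
  exit⇒pathComponent {e} (e∈ , πe∉) =
    e , ε , π e , π-∈ (S⊆indices e∈) , πe∉
      , commonNeg-π (S⊆indices e∈) (λ πe≡e → πe∉ (subst (_∈ S) (sym πe≡e) e∈))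

  pathComponent⇒exit : ∀ {i} → i ∈ S → PathComponent t S n i → ∃ λ e → Exit e × Connected t S n i e
  pathComponent⇒exit {i} i∈ (k , i⇝k , j , j∈ , j∉ , common) = byCases (commonNeg-cases common)
    where
    k∈ : k ∈ S
    k∈ = connected-∈ i∈ i⇝k
    byCases : k ≡ j ⊎ j ≡ π k ⊎ k ≡ π j → ∃ λ e → Exit e × Connected t S n i e
    byCases (inj₁ k≡j) = ⊥-elim (j∉ (subst (_∈ S) k≡j k∈))
    byCases (inj₂ (inj₁ j≡πk)) = k , (k∈ , subst (_∉ S) j≡πk j∉) , i⇝k
    byCases (inj₂ (inj₂ k≡πj)) =
      let e , exit , πj⇝e = entry⇒exit j∈ j∉ (subst (_∈ S) k≡πj k∈)
      in e , exit , i⇝k ◅◅ subst (λ x → Connected t S n x e) (sym k≡πj) πj⇝e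

  exit? : Decidable Exit
  exit? j = (j ∈? S) ×-dec ¬? (π j ∈? S)

  exits : List ℕ
  exits = filter exit? (indices t)

  ∈-exits : ∀ {e} → e ∈ exits ⇔ Exit e
  ∈-exits = mk⇔ (proj₂ ∘ ∈-filter⁻ exit? {xs = indices t})
                (λ exit → ∈-filter⁺ exit? (S⊆indices (proj₁ exit)) exit)

  open CanonicalRepresentatives (Connected t S n) connected-sym _◅◅_
    (λ i → i ∈ S × PathComponent t S n i) Exit
    (λ exit → proj₁ exit , exit⇒pathComponent exit) (λ (i∈ , pc) → pathComponent⇒exit i∈ pc)
    exit-unique exits (Unique.filter⁺ exit? (indices-unique t)) ∈-exits

  pathCount⇔ : ∀ c → length exits ≡ c ⇔ PathCount t S n c
  pathCount⇔ c = mk⇔ (curried ∘ Equivalence.to (classCount⇔ c))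
                      (Equivalence.from (classCount⇔ c) ∘ uncurried)
    where
    curried : ClassCount c → PathCount t S n c
    curried (reps , len , qs , pairs , cover) = reps , len , qs , pairs , λ i i∈ pc → cover i (i∈ , pc)
    uncurried : PathCount t S n c → ClassCount c
    uncurried (reps , len , qs , pairs , cover) = reps , len , qs , pairs , λ i (i∈ , pc) → cover i i∈ pc

module RowSum (t : ℕ) .{{_ : NonZero t}} (S : List ℕ) (n : ℕ)
              (n∈ : n ∈ indices t) (S⊆ : All (_∈ indices t) S) (S-unique : Unique S) where

  open import Data.Integer using (_+_; _*_)
  open Components t S n n∈ S⊆

  inS : ℕ → Bool
  inS j = does (j ∈? S)

  ∑[_] : (ℕ → ℤ) → ℤ
  ∑[ f ] = ∑ (map f (indices t))

  N*R : ℕ → ℤ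
  N*R j = Nprod t S n j * Rm t n j

  Nprod≡sign : ∀ j → Nprod t S n j ≡ sign (inS j) * sign (inS (π j))
  Nprod≡sign j = trans (∏-map-* (λ i → δ t i j) (λ i → δ t i (π j)) S)
                       (cong₂ _*_ (∏-δ t j S-unique) (∏-δ t (π j) S-unique))

  Mmat≡sign*N*R : ∀ j → Mmat t S n j ≡ sign (inS n) * N*R j
  Mmat≡sign*N*R j = begin
    ∏ (map (λ i → δ t i n * δ t i j * δ t i (π j)) S) * Rm t n j
      ≡⟨ cong (_* Rm t n j) (∏-map-* (λ i → δ t i n * δ t i j) (λ i → δ t i (π j)) S) ⟩
    ∏ (map (λ i → δ t i n * δ t i j) S) * ∏δ (π j) * Rm t n j
      ≡⟨ cong (λ x → x * ∏δ (π j) * Rm t n j) (∏-map-* (λ i → δ t i n) (λ i → δ t i j) S) ⟩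
    ∏δ n * ∏δ j * ∏δ (π j) * Rm t n j
      ≡⟨ reassociate (∏δ n) (∏δ j) (∏δ (π j)) (Rm t n j) ⟩
    ∏δ n * (∏δ j * ∏δ (π j) * Rm t n j)
      ≡⟨ cong₂ (λ x y → x * (y * Rm t n j)) (∏-δ t n S-unique)
               (sym (∏-map-* (λ i → δ t i j) (λ i → δ t i (π j)) S)) ⟩
    sign (inS n) * N*R j ∎
    where
    open ≡-Reasoning
    ∏δ : ℕ → ℤ
    ∏δ k = ∏ (map (λ i → δ t i k) S)
    reassociate : ∀ a b c d → a * b * c * d ≡ a * (b * c * d)
    reassociate = solve-∀

  rowSum≡ : rowSum t S n ≡ sign (inS n) * ∑[ N*R ]
  rowSum≡ = trans (∑-map-cong (indices t) Mmat≡sign*N*R) (∑-map-* (sign (inS n)) N*R (indices t))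

  rowSum≡0⇔ : rowSum t S n ≡ 0ℤ ⇔ ∑[ N*R ] ≡ 0ℤ
  rowSum≡0⇔ = mk⇔ to from
    where
    sign≢0 : ∀ b → sign b ≢ 0ℤ
    sign≢0 true ()
    sign≢0 false ()
    to : rowSum t S n ≡ 0ℤ → ∑[ N*R ] ≡ 0ℤ
    to rowSum≡0 = [ ⊥-elim ∘ sign≢0 (inS n) , id ]′
                    (ℤP.i*j≡0⇒i≡0∨j≡0 (sign (inS n)) (trans (sym rowSum≡) rowSum≡0))
    from : ∑[ N*R ] ≡ 0ℤ → rowSum t S n ≡ 0ℤ
    from Σ≡0 = trans rowSum≡ (trans (cong (sign (inS n) *_) Σ≡0) (ℤP.*-zeroʳ (sign (inS n))))

  R-negative : ℕ → ℤ
  R-negative j = indicator (does (Rm t n j ℤ.≟ -1ℤ))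

  I-column? : Decidable (λ j → Rm t n j ≡ -1ℤ × Nprod t S n j ≡ -1ℤ)
  I-column? j = (Rm t n j ℤ.≟ -1ℤ) ×-dec (Nprod t S n j ℤ.≟ -1ℤ)

  I-column : ℕ → ℤ
  I-column j = indicator (does (I-column? j))

  column-lhs column-rhs : ℕ → ℤ
  column-lhs j = N*R j + + 4 * indicator (does (exit? j)) + + 2 * indicator (inS (π j)) + + 2 * R-negative j
  column-rhs j = 1ℤ + + 2 * indicator (inS j) + + 4 * I-column j

  column-identity-at : ∀ j → column-lhs j ≡ column-rhs j
  column-identity-at j = column-identity (inS j) (inS (π j)) (Nprod≡sign j) (A≡±1 t (uvPart t n) (uvPart t j))

  members : ℤ
  members = ∑[ indicator ∘ inS ]

  ∑-inS∘π : ∑[ indicator ∘ inS ∘ π ] ≡ members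
  ∑-inS∘π = trans (cong ∑ (List.map-∘ (indices t))) (∑-↭ (Perm.map⁺ (indicator ∘ inS) map-π↭indices))

  ∑-column-lhs : ∑[ column-lhs ] ≡ ∑[ N*R ] + + 4 * + length exits + + 2 * members + + 2 * ∑[ R-negative ]
  ∑-column-lhs = begin
    ∑[ column-lhs ]
      ≡⟨ ∑-map-+* _ (+ 2) R-negative (indices t) ⟩
    ∑[ (λ j → N*R j + + 4 * indicator (does (exit? j)) + + 2 * indicator (inS (π j))) ] + + 2 * ∑[ R-negative ]
      ≡⟨ cong (_+ + 2 * ∑[ R-negative ]) (∑-map-+* _ (+ 2) (indicator ∘ inS ∘ π) (indices t)) ⟩
    ∑[ (λ j → N*R j + + 4 * indicator (does (exit? j))) ] + + 2 * ∑[ indicator ∘ inS ∘ π ] + + 2 * ∑[ R-negative ]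
      ≡⟨ cong (λ x → x + + 2 * ∑[ indicator ∘ inS ∘ π ] + + 2 * ∑[ R-negative ])
              (∑-map-+* N*R (+ 4) (indicator ∘ does ∘ exit?) (indices t)) ⟩
    ∑[ N*R ] + + 4 * ∑[ indicator ∘ does ∘ exit? ] + + 2 * ∑[ indicator ∘ inS ∘ π ] + + 2 * ∑[ R-negative ]
      ≡⟨ cong₂ (λ e b → ∑[ N*R ] + + 4 * e + + 2 * b + + 2 * ∑[ R-negative ])
               (sym (length-filter≡∑-indicator exit? (indices t))) ∑-inS∘π ⟩
    ∑[ N*R ] + + 4 * + length exits + + 2 * members + + 2 * ∑[ R-negative ] ∎
    where open ≡-Reasoning

  ∑-column-rhs : ∑[ column-rhs ] ≡ + 4 * + t + + 2 * members + + 4 * + I t S n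
  ∑-column-rhs = begin
    ∑[ column-rhs ]
      ≡⟨ ∑-map-+* _ (+ 4) I-column (indices t) ⟩
    ∑[ (λ j → 1ℤ + + 2 * indicator (inS j)) ] + + 4 * ∑[ I-column ]
      ≡⟨ cong (_+ + 4 * ∑[ I-column ]) (∑-map-+* (λ _ → 1ℤ) (+ 2) (indicator ∘ inS) (indices t)) ⟩
    ∑[ (λ _ → 1ℤ) ] + + 2 * members + + 4 * ∑[ I-column ]
      ≡⟨ cong₂ (λ c i → c + + 2 * members + + 4 * i) ∑-1 (sym (length-filter≡∑-indicator I-column? (indices t))) ⟩
    + 4 * + t + + 2 * members + + 4 * + I t S n ∎
    where
    open ≡-Reasoning
    ∑-1 : ∑[ (λ _ → 1ℤ) ] ≡ + 4 * + t
    ∑-1 = trans (∑-map-1 (indices t)) (trans (cong +_ (length-indices t)) (ℤP.pos-* 4 t))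

  row-identity : ∑[ N*R ] + + 4 * + length exits + + 2 * ∑[ R-negative ] ≡ + 4 * + t + + 4 * + I t S n
  row-identity = ∙-cancelʳ (+ 2 * members) _ _ (begin
    ∑[ N*R ] + + 4 * + length exits + + 2 * ∑[ R-negative ] + + 2 * members
      ≡⟨ xy∙z≈xz∙y (∑[ N*R ] + + 4 * + length exits) _ _ ⟩
    ∑[ N*R ] + + 4 * + length exits + + 2 * members + + 2 * ∑[ R-negative ]
      ≡⟨ ∑-column-lhs ⟨
    ∑[ column-lhs ]
      ≡⟨ ∑-map-cong (indices t) column-identity-at ⟩
    ∑[ column-rhs ]
      ≡⟨ ∑-column-rhs ⟩
    + 4 * + t + + 2 * members + + 4 * + I t S n
      ≡⟨ xy∙z≈xz∙y (+ 4 * + t) _ _ ⟩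
    + 4 * + t + + 4 * + I t S n + + 2 * members ∎)
    where open ≡-Reasoning

  R-negatives≡ : ∑[ R-negative ] ≡ + t * A-negatives t (uvPart t n)
  R-negatives≡ = ∑-indices-uvPart t (λ k → indicator (does (A t (uvPart t n) k ℤ.≟ -1ℤ)))

  module _ (uvPart≡0 : uvPart t n ≡ 0) where

    R-row-trivial : ∀ j → Rm t n j ≡ 1ℤ
    R-row-trivial j = cong (λ r → A t r (uvPart t j)) uvPart≡0

    I≡0 : I t S n ≡ 0
    I≡0 = cong length (List.filter-none I-column? {indices t}
      (All.tabulate λ {j} _ (R≡-1 , _) → 1≢-1 (trans (sym (R-row-trivial j)) R≡-1)))
      where
      1≢-1 : 1ℤ ≢ -1ℤ
      1≢-1 ()

    R-negatives≡0 : ∑[ R-negative ] ≡ 0ℤ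
    R-negatives≡0 = trans R-negatives≡ (trans (cong (λ r → + t * A-negatives t r) uvPart≡0) (ℤP.*-zeroʳ (+ t)))

    rowSum≡0⇔exits≡t : rowSum t S n ≡ 0ℤ ⇔ length exits ≡ t
    rowSum≡0⇔exits≡t = s+4e≡4x⇒[s≡0⇔e≡x] ∑[ N*R ] (length exits) t (begin
      base                               ≡⟨ ℤP.+-identityʳ base ⟨
      base + + 2 * 0ℤ                    ≡⟨ cong (λ r → base + + 2 * r) R-negatives≡0 ⟨
      base + + 2 * ∑[ R-negative ]       ≡⟨ row-identity ⟩
      + 4 * + t + + 4 * + I t S n        ≡⟨ cong (λ i → + 4 * + t + + 4 * + i) I≡0 ⟩
      + 4 * + t + 0ℤ                     ≡⟨ ℤP.+-identityʳ _ ⟩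
      + 4 * + t                          ∎)
      ⇔-∘ rowSum≡0⇔
      where
      open ≡-Reasoning
      base : ℤ
      base = ∑[ N*R ] + + 4 * + length exits

  rowSum≡0⇔exits≡I : uvPart t n ≢ 0 → rowSum t S n ≡ 0ℤ ⇔ length exits ≡ I t S n
  rowSum≡0⇔exits≡I uvPart≢0 =
    s+4e≡4x⇒[s≡0⇔e≡x] ∑[ N*R ] (length exits) (I t S n) (∙-cancelʳ (+ 4 * + t) _ _ (begin
      base + + 4 * + t                   ≡⟨ double base (+ t) ⟩
      base + + 2 * (+ t * + 2)           ≡⟨ cong (λ r → base + + 2 * r) R-negatives≡2t ⟨
      base + + 2 * ∑[ R-negative ]       ≡⟨ row-identity ⟩
      + 4 * + t + + 4 * + I t S n        ≡⟨ ℤP.+-comm (+ 4 * + t) _ ⟩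
      + 4 * + I t S n + + 4 * + t        ∎))
    ⇔-∘ rowSum≡0⇔
    where
    open ≡-Reasoning
    base : ℤ
    base = ∑[ N*R ] + + 4 * + length exits
    double : ∀ a b → a + + 4 * b ≡ a + + 2 * (b * + 2)
    double = solve-∀
    R-negatives≡2t : ∑[ R-negative ] ≡ + t * + 2
    R-negatives≡2t = trans R-negatives≡ (cong (+ t *_) (A-negatives≡2 t (uvPart<4 t n) uvPart≢0))

open import Data.Nat using (_*_; _∸_)

corollary1 : (t : ℕ) .{{_ : NonZero t}} → 1 < t → t % 2 ≡ 1 →
    (S : List ℕ) → Unique S → All (λ i → 2 ≤ i × i ≤ 4 * t ∸ 2) S →
    (n : ℕ) → 2 ≤ n → n ≤ 4 * t →
      (n % 4 ≡ 1 → (rowSum t S n ≡ 0ℤ) ⇔ PathCount t S n t)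
    × (n % 4 ≢ 1 → (rowSum t S n ≡ 0ℤ) ⇔ PathCount t S n (I t S n))
corollary1 t _ _ S S-unique S-bounds n 2≤n n≤4t =
    (λ n%4≡1 → pathCount⇔ t ⇔-∘ rowSum≡0⇔exits≡t (Equivalence.to n%4≡1⇔uvPart≡0 n%4≡1))
  , (λ n%4≢1 → pathCount⇔ (I t S n) ⇔-∘ rowSum≡0⇔exits≡I (n%4≢1 ∘ Equivalence.from n%4≡1⇔uvPart≡0))
  where
  2≤⇒1≤ : ∀ {i} → 2 ≤ i → 1 ≤ i
  2≤⇒1≤ = ℕP.≤-trans (s≤s z≤n)
  n∈ : n ∈ indices t
  n∈ = ∈-indices⁺ t (2≤⇒1≤ 2≤n) n≤4t
  S⊆ : All (_∈ indices t) S
  S⊆ = All.map (λ (2≤i , i≤) → ∈-indices⁺ t (2≤⇒1≤ 2≤i) (ℕP.≤-trans i≤ (ℕP.m∸n≤m (4 * t) 2))) S-bounds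
  n%4≡1⇔uvPart≡0 : n % 4 ≡ 1 ⇔ uvPart t n ≡ 0
  n%4≡1⇔uvPart≡0 = %4≡1⇔uvPart≡0 t (2≤⇒1≤ 2≤n)
  open Components t S n n∈ S⊆ using (pathCount⇔)
  open RowSum t S n n∈ S⊆ S-unique using (rowSum≡0⇔exits≡t; rowSum≡0⇔exits≡I)
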